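{- Let $m$ and $\Delta<0$ be numbers such that the ball $[m,\Delta]$ is a balanced number, and suppose $m=\frac{a}{2^p}\neq 0$ where $p\ge 0$ is an integer and either $a$ is odd or $p=0$. Then $-\frac{1}{2^p}\le\Delta<0$.
   Context: Games are short normal-play combinatorial games with the usual disjunctive sum, order and equality. Values of short numbers are identified with dyadic rationals. For numbers $m$ and $\Delta$, the ball $[m,\Delta]$ is the game $\{x\mid y\}$ where $x,y$ are the canonical forms of $m+\Delta$ and $m-\Delta$. A ball $[m,\Delta]$ is balanced if $[m,\Delta]+[m,\Delta]=m+m$. Recall (Simplicity Theorem) that for numbers $x<y$, $\{x\mid y\}$ equals the number of smallest birthday in the open interval $(x,y)$. -}

module Defs where

open import Data.Nat as ℕ using (ℕ; zero; suc)
open import Data.Integer as ℤ using (ℤ; +_; -[1+_])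
open import Data.Integer.DivMod using (_/ℕ_; _%ℕ_)
open import Data.List using (List; []; _∷_; _++_)
open import Data.Product using (_×_; Σ)
open import Data.Unit using (⊤)
open import Relation.Nullary using (¬_)
open import Relation.Binary.PropositionalEquality using (_≡_)

data Game : Set where
  ⟨_∣_⟩ : List Game → List Game → Game

leftOpts : Game → List Game
leftOpts ⟨ L ∣ _ ⟩ = L

rightOpts : Game → List Game
rightOpts ⟨ _ ∣ R ⟩ = R

mutual
  infix 4 _≤G_
  _≤G_ : Game → Game → Set
  ⟨ GL ∣ GR ⟩ ≤G ⟨ HL ∣ HR ⟩ = NoLeftAbove GL ⟨ HL ∣ HR ⟩ × NoRightBelow ⟨ GL ∣ GR ⟩ HR

  NoLeftAbove : List Game → Game → Set
  NoLeftAbove []         H = ⊤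
  NoLeftAbove (gl ∷ gls) H = ¬ (H ≤G gl) × NoLeftAbove gls H

  NoRightBelow : Game → List Game → Set
  NoRightBelow G []         = ⊤
  NoRightBelow G (hr ∷ hrs) = ¬ (hr ≤G G) × NoRightBelow G hrs

infix 4 _≈G_
_≈G_ : Game → Game → Set
G ≈G H = (G ≤G H) × (H ≤G G)

mutual
  infixl 6 _+G_
  _+G_ : Game → Game → Game
  G@(⟨ GL ∣ GR ⟩) +G H@(⟨ HL ∣ HR ⟩) =
    ⟨ addOptsˡ GL H ++ addOptsʳ G HL ∣ addOptsˡ GR H ++ addOptsʳ G HR ⟩

  addOptsˡ : List Game → Game → List Game
  addOptsˡ []       H = []
  addOptsˡ (g ∷ gs) H = (g +G H) ∷ addOptsˡ gs H

  addOptsʳ : Game → List Game → List Game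
  addOptsʳ G []       = []
  addOptsʳ G (h ∷ hs) = (G +G h) ∷ addOptsʳ G hs

-- Dyadic rationals a / 2^p (not necessarily reduced).

record Dyadic : Set where
  constructor _/2^_
  field
    num : ℤ
    exp : ℕ
open Dyadic public

pow2 : ℕ → ℤ
pow2 p = + (2 ℕ.^ p)

infixl 6 _+D_ _-D_
_+D_ : Dyadic → Dyadic → Dyadic
(a /2^ p) +D (b /2^ q) = (a ℤ.* pow2 q ℤ.+ b ℤ.* pow2 p) /2^ (p ℕ.+ q)

-D_ : Dyadic → Dyadic
-D (a /2^ p) = (ℤ.- a) /2^ p

_-D_ : Dyadic → Dyadic → Dyadic
x -D y = x +D (-D y)

infix 4 _≤D_ _<D_ _≃D_
_≤D_ : Dyadic → Dyadic → Set
(a /2^ p) ≤D (b /2^ q) = a ℤ.* pow2 q ℤ.≤ b ℤ.* pow2 p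

_<D_ : Dyadic → Dyadic → Set
(a /2^ p) <D (b /2^ q) = a ℤ.* pow2 q ℤ.< b ℤ.* pow2 p

_≃D_ : Dyadic → Dyadic → Set
(a /2^ p) ≃D (b /2^ q) = a ℤ.* pow2 q ≡ b ℤ.* pow2 p

canonℕ : ℕ → Game
canonℕ zero    = ⟨ [] ∣ [] ⟩
canonℕ (suc n) = ⟨ canonℕ n ∷ [] ∣ [] ⟩

canonNeg : ℕ → Game
canonNeg zero    = ⟨ [] ∣ [] ⟩
canonNeg (suc n) = ⟨ [] ∣ canonNeg n ∷ [] ⟩

canonℤ : ℤ → Game
canonℤ (+ n)      = canonℕ n
canonℤ -[1+ n ]   = canonNeg (suc n)

-- a / 2^p: if p = 0 it is the integer a; if a is even reduce to (a/2)/2^(p-1);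
-- if a is odd and p ≥ 1 it is { (a-1)/2^p | (a+1)/2^p } with both ends reduced,
-- i.e. { ⌊a/2⌋ / 2^(p-1) | (⌊a/2⌋+1) / 2^(p-1) }.
canonAt : ℤ → ℕ → Game
canonAt a zero = canonℤ a
canonAt a (suc p) with a %ℕ 2
... | zero  = canonAt (a /ℕ 2) p
... | suc _ = ⟨ canonAt (a /ℕ 2) p ∷ [] ∣ canonAt ((a /ℕ 2) ℤ.+ ℤ.1ℤ) p ∷ [] ⟩

canon : Dyadic → Game
canon (a /2^ p) = canonAt a p

IsNumber : Game → Set
IsNumber G = Σ Dyadic λ x → G ≈G canon x

ball : Dyadic → Dyadic → Game
ball m Δ = ⟨ canon (m +D Δ) ∷ [] ∣ canon (m -D Δ) ∷ [] ⟩

IsBalanced : Dyadic → Dyadic → Set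
IsBalanced m Δ = ball m Δ +G ball m Δ ≈G canon m +G canon m

IsBalancedNumber : Dyadic → Dyadic → Set
IsBalancedNumber m Δ = IsNumber (ball m Δ) × IsBalanced m Δ

0D : Dyadic
0D = (+ 0) /2^ 0

OddInt : ℤ → Set
OddInt a = Σ ℤ λ k → a ≡ + 2 ℤ.* k ℤ.+ ℤ.1ℤ

-- A ball G = { m+Δ | m-Δ } that is a number is comparable with m, so cancelling in
-- G + G = m + m gives G = m.  Canonical forms of dyadics are ordered like their values;
-- this is the Simplicity Theorem, whose arithmetic core is that strictly between two
-- consecutive multiples of 2^-e lie only dyadics of exponent larger than e.
-- For m = a/2^p > 0 with a odd or p = 0, the canonical form of m has the left option
-- L = m - 2^-p, all of whose right options exceed m (for m < 0 use the right option
-- m + 1 symmetrically).  If Δ < -2^-p then m+Δ < L, hence G ≤ L; but L is a left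
-- option of m = G, so G ≰ L.

module Submission where

open import Defs
open import Data.Nat as ℕ using (ℕ; zero; suc)
import Data.Nat.Properties as ℕP
import Data.Integer
open import Data.Integer as ℤ using (ℤ; +_; +[1+_]; -[1+_]; -_; 1ℤ)
import Data.Integer.Properties as ℤP
open import Data.Integer.DivMod using (_/ℕ_; _%ℕ_; n%ℕd<d; a≡a%ℕn+[a/ℕn]*n)
open import Data.Integer.Tactic.RingSolver using (solve-∀)
open import Data.Rational.Unnormalised as ℚ using (ℚᵘ; mkℚᵘ; ↥_; ↧_; *≤*; *<*; *≡*)
import Data.Rational.Unnormalised.Properties as ℚP
open import Data.List using (List; []; _∷_; _++_; map)
open import Data.List.Membership.Propositional using (_∈_)
open import Data.List.Membership.Propositional.Properties using (∈-map⁺; ∈-map⁻; ∈-++⁺ˡ; ∈-++⁺ʳ; ∈-++⁻)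
open import Data.List.Relation.Unary.Any using (here; there)
open import Data.Product using (_×_; _,_; Σ)
open import Data.Sum as Sum using (_⊎_; inj₁; inj₂; [_,_]′)
open import Data.Unit using (tt)
open import Data.Empty using (⊥; ⊥-elim)
open import Function using (_∘_)
open import Induction.WellFounded using (WellFounded; Acc; acc)
open import Relation.Nullary using (¬_; yes; no)
open import Relation.Binary.Structures using (IsPreorder; IsEquivalence)
open import Relation.Binary.PropositionalEquality
  using (_≡_; _≢_; refl; sym; trans; cong; cong₂; subst; subst₂; module ≡-Reasoning)

Option : Game → Game → Set
Option x G = x ∈ leftOpts G ⊎ x ∈ rightOpts G

mutual
  option-wellFounded : WellFounded Option
  option-wellFounded ⟨ L ∣ R ⟩ = acc λ { (inj₁ x∈L) → listed-acc L x∈L ; (inj₂ x∈R) → listed-acc R x∈R }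

  listed-acc : ∀ xs {x} → x ∈ xs → Acc Option x
  listed-acc (x ∷ _)  (here refl)  = option-wellFounded x
  listed-acc (_ ∷ xs) (there x∈xs) = listed-acc xs x∈xs

noLeftAbove⁻ : ∀ {GL H x} → NoLeftAbove GL H → x ∈ GL → ¬ H ≤G x
noLeftAbove⁻ {_ ∷ _} (H≰x , _)  (here refl)  = H≰x
noLeftAbove⁻ {_ ∷ _} (_ , rest) (there x∈GL) = noLeftAbove⁻ rest x∈GL

noLeftAbove⁺ : ∀ GL {H} → (∀ {x} → x ∈ GL → ¬ H ≤G x) → NoLeftAbove GL H
noLeftAbove⁺ []       f = tt
noLeftAbove⁺ (_ ∷ GL) f = f (here refl) , noLeftAbove⁺ GL (f ∘ there)

noRightBelow⁻ : ∀ {G HR x} → NoRightBelow G HR → x ∈ HR → ¬ x ≤G G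
noRightBelow⁻ {_} {_ ∷ _} (x≰G , _)  (here refl)  = x≰G
noRightBelow⁻ {_} {_ ∷ _} (_ , rest) (there x∈HR) = noRightBelow⁻ rest x∈HR

noRightBelow⁺ : ∀ {G} HR → (∀ {x} → x ∈ HR → ¬ x ≤G G) → NoRightBelow G HR
noRightBelow⁺ []       f = tt
noRightBelow⁺ (_ ∷ HR) f = f (here refl) , noRightBelow⁺ HR (f ∘ there)

≤G-intro : ∀ {G H} → (∀ {x} → x ∈ leftOpts G → ¬ H ≤G x) → (∀ {x} → x ∈ rightOpts H → ¬ x ≤G G) → G ≤G H
≤G-intro {⟨ GL ∣ _ ⟩} {⟨ _ ∣ HR ⟩} f g = noLeftAbove⁺ GL f , noRightBelow⁺ HR g

≤G-elimˡ : ∀ {G H x} → G ≤G H → x ∈ leftOpts G → ¬ H ≤G x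
≤G-elimˡ {⟨ _ ∣ _ ⟩} {⟨ _ ∣ _ ⟩} (noLeft , _) = noLeftAbove⁻ noLeft

≤G-elimʳ : ∀ {G H x} → G ≤G H → x ∈ rightOpts H → ¬ x ≤G G
≤G-elimʳ {⟨ _ ∣ _ ⟩} {⟨ _ ∣ _ ⟩} (_ , noRight) = noRightBelow⁻ noRight

≤G-refl-acc : ∀ {G} → Acc Option G → G ≤G G
≤G-refl-acc (acc rs) = ≤G-intro (λ x∈ G≤x → ≤G-elimˡ G≤x x∈ (≤G-refl-acc (rs (inj₁ x∈))))
                                (λ x∈ x≤G → ≤G-elimʳ x≤G x∈ (≤G-refl-acc (rs (inj₂ x∈))))

≤G-refl : ∀ G → G ≤G G
≤G-refl G = ≤G-refl-acc (option-wellFounded G)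

¬≤leftOpt : ∀ {G x} → x ∈ leftOpts G → ¬ G ≤G x
¬≤leftOpt {x = x} x∈ G≤x = ≤G-elimˡ G≤x x∈ (≤G-refl x)

¬rightOpt≤ : ∀ {G x} → x ∈ rightOpts G → ¬ x ≤G G
¬rightOpt≤ {x = x} x∈ x≤G = ≤G-elimʳ x≤G x∈ (≤G-refl x)

≤G-trans-acc : ∀ {G H K} → Acc Option G → Acc Option H → Acc Option K → G ≤G H → H ≤G K → G ≤G K
≤G-trans-acc (acc rg) ah (acc rk) G≤H H≤K =
  ≤G-intro (λ x∈ K≤x → ≤G-elimˡ G≤H x∈ (≤G-trans-acc ah (acc rk) (rg (inj₁ x∈)) H≤K K≤x))
           (λ x∈ x≤G → ≤G-elimʳ H≤K x∈ (≤G-trans-acc (rk (inj₂ x∈)) (acc rg) ah x≤G G≤H))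

≤G-trans : ∀ {G H K} → G ≤G H → H ≤G K → G ≤G K
≤G-trans {G} {H} {K} = ≤G-trans-acc (option-wellFounded G) (option-wellFounded H) (option-wellFounded K)

addOptsˡ≡map : ∀ xs H → addOptsˡ xs H ≡ map (_+G H) xs
addOptsˡ≡map []       H = refl
addOptsˡ≡map (x ∷ xs) H = cong (x +G H ∷_) (addOptsˡ≡map xs H)

addOptsʳ≡map : ∀ G xs → addOptsʳ G xs ≡ map (G +G_) xs
addOptsʳ≡map G []       = refl
addOptsʳ≡map G (x ∷ xs) = cong (G +G x ∷_) (addOptsʳ≡map G xs)

leftOpts-+G : ∀ G H → leftOpts (G +G H) ≡ map (_+G H) (leftOpts G) ++ map (G +G_) (leftOpts H)
leftOpts-+G G@(⟨ GL ∣ _ ⟩) H@(⟨ HL ∣ _ ⟩) = cong₂ _++_ (addOptsˡ≡map GL H) (addOptsʳ≡map G HL)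

rightOpts-+G : ∀ G H → rightOpts (G +G H) ≡ map (_+G H) (rightOpts G) ++ map (G +G_) (rightOpts H)
rightOpts-+G G@(⟨ _ ∣ GR ⟩) H@(⟨ _ ∣ HR ⟩) = cong₂ _++_ (addOptsˡ≡map GR H) (addOptsʳ≡map G HR)

module SumOptions (opts : Game → List Game)
                  (opts-+G : ∀ G H → opts (G +G H) ≡ map (_+G H) (opts G) ++ map (G +G_) (opts H)) where

  data SumOption (G H : Game) : Game → Set where
    inˡ : ∀ {x} → x ∈ opts G → SumOption G H (x +G H)
    inʳ : ∀ {x} → x ∈ opts H → SumOption G H (G +G x)

  ∈-+G⁺ˡ : ∀ G H {x} → x ∈ opts G → x +G H ∈ opts (G +G H)
  ∈-+G⁺ˡ G H x∈ = subst (_ ∈_) (sym (opts-+G G H)) (∈-++⁺ˡ (∈-map⁺ (_+G H) x∈))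

  ∈-+G⁺ʳ : ∀ G H {x} → x ∈ opts H → G +G x ∈ opts (G +G H)
  ∈-+G⁺ʳ G H x∈ = subst (_ ∈_) (sym (opts-+G G H)) (∈-++⁺ʳ (map (_+G H) (opts G)) (∈-map⁺ (G +G_) x∈))

  ∈-+G⁻ : ∀ G H {y} → y ∈ opts (G +G H) → SumOption G H y
  ∈-+G⁻ G H y∈ with ∈-++⁻ (map (_+G H) (opts G)) (subst (_ ∈_) (opts-+G G H) y∈)
  ... | inj₁ y∈ˡ with ∈-map⁻ (_+G H) y∈ˡ
  ...   | _ , x∈ , refl = inˡ x∈
  ∈-+G⁻ G H y∈ | inj₂ y∈ʳ with ∈-map⁻ (G +G_) y∈ʳ
  ...   | _ , x∈ , refl = inʳ x∈

module Left  = SumOptions leftOpts leftOpts-+G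
module Right = SumOptions rightOpts rightOpts-+G

mutual
  +G-monoˡ-≤-acc : ∀ {G K H} → Acc Option G → Acc Option K → Acc Option H → G ≤G K → G +G H ≤G K +G H
  +G-monoˡ-≤-acc {G} {K} {H} (acc rg) (acc rk) (acc rh) G≤K = ≤G-intro left right
    where
    left : ∀ {y} → y ∈ leftOpts (G +G H) → ¬ K +G H ≤G y
    left y∈ K+H≤y with Left.∈-+G⁻ G H y∈
    ... | Left.inˡ x∈ = ≤G-elimˡ G≤K x∈ (+G-cancelʳ-≤-acc (acc rk) (rg (inj₁ x∈)) (acc rh) K+H≤y)
    ... | Left.inʳ x∈ = ¬≤leftOpt (Left.∈-+G⁺ʳ K H x∈) (≤G-trans K+H≤y (+G-monoˡ-≤-acc (acc rg) (acc rk) (rh (inj₁ x∈)) G≤K))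
    right : ∀ {y} → y ∈ rightOpts (K +G H) → ¬ y ≤G G +G H
    right y∈ y≤G+H with Right.∈-+G⁻ K H y∈
    ... | Right.inˡ x∈ = ≤G-elimʳ G≤K x∈ (+G-cancelʳ-≤-acc (rk (inj₂ x∈)) (acc rg) (acc rh) y≤G+H)
    ... | Right.inʳ x∈ = ¬rightOpt≤ (Right.∈-+G⁺ʳ G H x∈) (≤G-trans (+G-monoˡ-≤-acc (acc rg) (acc rk) (rh (inj₂ x∈)) G≤K) y≤G+H)

  +G-cancelʳ-≤-acc : ∀ {G K H} → Acc Option G → Acc Option K → Acc Option H → G +G H ≤G K +G H → G ≤G K
  +G-cancelʳ-≤-acc {G} {K} {H} (acc rg) (acc rk) ah G+H≤K+H = ≤G-intro
    (λ x∈ K≤x → ¬≤leftOpt (Left.∈-+G⁺ˡ G H x∈) (≤G-trans G+H≤K+H (+G-monoˡ-≤-acc (acc rk) (rg (inj₁ x∈)) ah K≤x)))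
    (λ x∈ x≤G → ¬rightOpt≤ (Right.∈-+G⁺ˡ K H x∈) (≤G-trans (+G-monoˡ-≤-acc (rk (inj₂ x∈)) (acc rg) ah x≤G) G+H≤K+H))

mutual
  +G-monoʳ-≤-acc : ∀ {G K H} → Acc Option G → Acc Option K → Acc Option H → G ≤G K → H +G G ≤G H +G K
  +G-monoʳ-≤-acc {G} {K} {H} (acc rg) (acc rk) (acc rh) G≤K = ≤G-intro left right
    where
    left : ∀ {y} → y ∈ leftOpts (H +G G) → ¬ H +G K ≤G y
    left y∈ H+K≤y with Left.∈-+G⁻ H G y∈
    ... | Left.inʳ x∈ = ≤G-elimˡ G≤K x∈ (+G-cancelˡ-≤-acc (acc rk) (rg (inj₁ x∈)) (acc rh) H+K≤y)
    ... | Left.inˡ x∈ = ¬≤leftOpt (Left.∈-+G⁺ˡ H K x∈) (≤G-trans H+K≤y (+G-monoʳ-≤-acc (acc rg) (acc rk) (rh (inj₁ x∈)) G≤K))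
    right : ∀ {y} → y ∈ rightOpts (H +G K) → ¬ y ≤G H +G G
    right y∈ y≤H+G with Right.∈-+G⁻ H K y∈
    ... | Right.inʳ x∈ = ≤G-elimʳ G≤K x∈ (+G-cancelˡ-≤-acc (rk (inj₂ x∈)) (acc rg) (acc rh) y≤H+G)
    ... | Right.inˡ x∈ = ¬rightOpt≤ (Right.∈-+G⁺ˡ H G x∈) (≤G-trans (+G-monoʳ-≤-acc (acc rg) (acc rk) (rh (inj₂ x∈)) G≤K) y≤H+G)

  +G-cancelˡ-≤-acc : ∀ {G K H} → Acc Option G → Acc Option K → Acc Option H → H +G G ≤G H +G K → G ≤G K
  +G-cancelˡ-≤-acc {G} {K} {H} (acc rg) (acc rk) ah H+G≤H+K = ≤G-intro
    (λ x∈ K≤x → ¬≤leftOpt (Left.∈-+G⁺ʳ H G x∈) (≤G-trans H+G≤H+K (+G-monoʳ-≤-acc (acc rk) (rg (inj₁ x∈)) ah K≤x)))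
    (λ x∈ x≤G → ¬rightOpt≤ (Right.∈-+G⁺ʳ H K x∈) (≤G-trans (+G-monoʳ-≤-acc (rk (inj₂ x∈)) (acc rg) ah x≤G) H+G≤H+K))

+G-monoʳ-≤ : ∀ {G K} H → G ≤G K → H +G G ≤G H +G K
+G-monoʳ-≤ {G} {K} H = +G-monoʳ-≤-acc (option-wellFounded G) (option-wellFounded K) (option-wellFounded H)

+G-cancelʳ-≤ : ∀ {G K} H → G +G H ≤G K +G H → G ≤G K
+G-cancelʳ-≤ {G} {K} H = +G-cancelʳ-≤-acc (option-wellFounded G) (option-wellFounded K) (option-wellFounded H)

-- Comparability cannot be dropped: * + * = 0 + 0 although * ≠ 0.
≈G-of-doubles : ∀ {G M} → G +G G ≈G M +G M → G ≤G M ⊎ M ≤G G → G ≈G M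
≈G-of-doubles {G} {M} (_ , M+M≤G+G) (inj₁ G≤M) = G≤M , +G-cancelʳ-≤ M (≤G-trans M+M≤G+G (+G-monoʳ-≤ G G≤M))
≈G-of-doubles {G} {M} (G+G≤M+M , _) (inj₂ M≤G) = +G-cancelʳ-≤ G (≤G-trans G+G≤M+M (+G-monoʳ-≤ M M≤G)) , M≤G

i<i+1 : ∀ i → i ℤ.< i ℤ.+ 1ℤ
i<i+1 i = ℤP.suc[i]≤j⇒i<j (ℤP.≤-reflexive (ℤP.+-comm 1ℤ i))

no-integer-strictly-between : ∀ {i j} → i ℤ.< j → j ℤ.< i ℤ.+ 1ℤ → ⊥
no-integer-strictly-between {i} {j} i<j j<i+1 =
  ℤP.<⇒≱ j<i+1 (subst (ℤ._≤ j) (ℤP.+-comm 1ℤ i) (ℤP.i<j⇒suc[i]≤j i<j))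

-[1+n]+1≡-n : ∀ n → -[1+ n ] ℤ.+ 1ℤ ≡ - + n
-[1+n]+1≡-n zero    = refl
-[1+n]+1≡-n (suc n) = refl

data Parity (a : ℤ) : Set where
  even : a %ℕ 2 ≡ 0 → a ≡ + 2 ℤ.* (a /ℕ 2) → Parity a
  odd  : a %ℕ 2 ≡ 1 → a ≡ + 2 ℤ.* (a /ℕ 2) ℤ.+ 1ℤ → Parity a

parity : ∀ a → Parity a
parity a with a %ℕ 2 in a%2≡ | n%ℕd<d a 2 | a≡a%ℕn+[a/ℕn]*n a 2
... | 0           | _                 | a≡ = even a%2≡ (trans a≡ (regroup₀ (a /ℕ 2)))
  where regroup₀ : ∀ h → + 0 ℤ.+ h ℤ.* + 2 ≡ + 2 ℤ.* h
        regroup₀ = solve-∀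
... | 1           | _                 | a≡ = odd a%2≡ (trans a≡ (regroup₁ (a /ℕ 2)))
  where regroup₁ : ∀ h → + 1 ℤ.+ h ℤ.* + 2 ≡ + 2 ℤ.* h ℤ.+ 1ℤ
        regroup₁ = solve-∀
... | suc (suc _) | ℕ.s≤s (ℕ.s≤s ()) | _

even≢odd : ∀ h k → + 2 ℤ.* h ≢ + 2 ℤ.* k ℤ.+ 1ℤ
even≢odd h k 2h≡2k+1 = no-integer-strictly-between k<h (ℤP.*-cancelˡ-<-nonNeg (+ 2) 2h<2k+2)
  where
  2k<2k+1 : + 2 ℤ.* k ℤ.< + 2 ℤ.* k ℤ.+ 1ℤ
  2k<2k+1 = i<i+1 (+ 2 ℤ.* k)
  k<h : k ℤ.< h
  k<h = ℤP.*-cancelˡ-<-nonNeg (+ 2) (subst (+ 2 ℤ.* k ℤ.<_) (sym 2h≡2k+1) 2k<2k+1)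
  2h<2k+2 : + 2 ℤ.* h ℤ.< + 2 ℤ.* (k ℤ.+ 1ℤ)
  2h<2k+2 = subst₂ ℤ._<_ (sym 2h≡2k+1) (regroup k) (i<i+1 (+ 2 ℤ.* k ℤ.+ 1ℤ))
    where regroup : ∀ k → + 2 ℤ.* k ℤ.+ 1ℤ ℤ.+ 1ℤ ≡ + 2 ℤ.* (k ℤ.+ 1ℤ)
          regroup = solve-∀

-- The order is transported from ℚᵘ, which stores the denominator minus one, so
-- ↧ ⟦ x ⟧ and pow2 (exp x) agree only propositionally.
⟦_⟧ : Dyadic → ℚᵘ
⟦ a /2^ p ⟧ = mkℚᵘ a (ℕ.pred (2 ℕ.^ p))

↧⟦⟧ : ∀ x → ↧ ⟦ x ⟧ ≡ pow2 (exp x)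
↧⟦⟧ x = cong +_ (ℕP.suc-pred (2 ℕ.^ exp x) {{ℕP.m^n≢0 2 (exp x)}})

module _ (R : ℤ → ℤ → Set) (x y : Dyadic) where

  cross⇒⟦⟧ : R (num x ℤ.* pow2 (exp y)) (num y ℤ.* pow2 (exp x)) → R (↥ ⟦ x ⟧ ℤ.* ↧ ⟦ y ⟧) (↥ ⟦ y ⟧ ℤ.* ↧ ⟦ x ⟧)
  cross⇒⟦⟧ = subst₂ R (cong (num x ℤ.*_) (sym (↧⟦⟧ y))) (cong (num y ℤ.*_) (sym (↧⟦⟧ x)))

  ⟦⟧⇒cross : R (↥ ⟦ x ⟧ ℤ.* ↧ ⟦ y ⟧) (↥ ⟦ y ⟧ ℤ.* ↧ ⟦ x ⟧) → R (num x ℤ.* pow2 (exp y)) (num y ℤ.* pow2 (exp x))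
  ⟦⟧⇒cross = subst₂ R (cong (num x ℤ.*_) (↧⟦⟧ y)) (cong (num y ℤ.*_) (↧⟦⟧ x))

⟦⟧-mono-≤ : ∀ x y → x ≤D y → ⟦ x ⟧ ℚ.≤ ⟦ y ⟧
⟦⟧-mono-≤ x y = *≤* ∘ cross⇒⟦⟧ ℤ._≤_ x y

⟦⟧-cancel-≤ : ∀ x y → ⟦ x ⟧ ℚ.≤ ⟦ y ⟧ → x ≤D y
⟦⟧-cancel-≤ x y (*≤* le) = ⟦⟧⇒cross ℤ._≤_ x y le

⟦⟧-mono-< : ∀ x y → x <D y → ⟦ x ⟧ ℚ.< ⟦ y ⟧
⟦⟧-mono-< x y = *<* ∘ cross⇒⟦⟧ ℤ._<_ x y

⟦⟧-cancel-< : ∀ x y → ⟦ x ⟧ ℚ.< ⟦ y ⟧ → x <D y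
⟦⟧-cancel-< x y (*<* lt) = ⟦⟧⇒cross ℤ._<_ x y lt

⟦⟧-mono-≃ : ∀ x y → x ≃D y → ⟦ x ⟧ ℚ.≃ ⟦ y ⟧
⟦⟧-mono-≃ x y = *≡* ∘ cross⇒⟦⟧ _≡_ x y

⟦⟧-cancel-≃ : ∀ x y → ⟦ x ⟧ ℚ.≃ ⟦ y ⟧ → x ≃D y
⟦⟧-cancel-≃ x y (*≡* eq) = ⟦⟧⇒cross _≡_ x y eq

≃D-isEquivalence : IsEquivalence _≃D_
≃D-isEquivalence = record
  { refl  = λ {x} → ⟦⟧-cancel-≃ x x ℚP.≃-refl
  ; sym   = λ {x} {y} x≃y → ⟦⟧-cancel-≃ y x (ℚP.≃-sym (⟦⟧-mono-≃ x y x≃y))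
  ; trans = λ {x} {y} {z} x≃y y≃z → ⟦⟧-cancel-≃ x z (ℚP.≃-trans (⟦⟧-mono-≃ x y x≃y) (⟦⟧-mono-≃ y z y≃z))
  }

≤D-isPreorder : IsPreorder _≃D_ _≤D_
≤D-isPreorder = record
  { isEquivalence = ≃D-isEquivalence
  ; reflexive     = λ {x} {y} x≃y → ⟦⟧-cancel-≤ x y (ℚP.≤-reflexive (⟦⟧-mono-≃ x y x≃y))
  ; trans         = λ {x} {y} {z} x≤y y≤z → ⟦⟧-cancel-≤ x z (ℚP.≤-trans (⟦⟧-mono-≤ x y x≤y) (⟦⟧-mono-≤ y z y≤z))
  }

<D⇒≤D : ∀ {x y} → x <D y → x ≤D y
<D⇒≤D {x} {y} = ⟦⟧-cancel-≤ x y ∘ ℚP.<⇒≤ ∘ ⟦⟧-mono-< x y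

module ≤D-Reasoning where
  open import Relation.Binary.Reasoning.Base.Triple
    ≤D-isPreorder
    (λ {x} {y} x<y y<x → ℚP.<-asym (⟦⟧-mono-< x y x<y) (⟦⟧-mono-< y x y<x))
    (λ {x} {y} {z} x<y y<z → ⟦⟧-cancel-< x z (ℚP.<-trans (⟦⟧-mono-< x y x<y) (⟦⟧-mono-< y z y<z)))
    ((λ {x} {y} {z} y≃z x<y → ⟦⟧-cancel-< x z (ℚP.<-respʳ-≃ (⟦⟧-mono-≃ y z y≃z) (⟦⟧-mono-< x y x<y)))
    , (λ {x} {y} {z} y≃z y<x → ⟦⟧-cancel-< z x (ℚP.<-respˡ-≃ (⟦⟧-mono-≃ y z y≃z) (⟦⟧-mono-< y x y<x))))
    (λ {x} {y} → <D⇒≤D {x} {y})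
    (λ {x} {y} {z} x<y y≤z → ⟦⟧-cancel-< x z (ℚP.<-≤-trans (⟦⟧-mono-< x y x<y) (⟦⟧-mono-≤ y z y≤z)))
    (λ {x} {y} {z} x≤y y<z → ⟦⟧-cancel-< x z (ℚP.≤-<-trans (⟦⟧-mono-≤ x y x≤y) (⟦⟧-mono-< y z y<z)))
    public

≤D-or->D : ∀ x y → x ≤D y ⊎ y <D x
≤D-or->D (a /2^ p) (b /2^ q) with a ℤ.* pow2 q ℤP.≤? b ℤ.* pow2 p
... | yes a≤b = inj₁ a≤b
... | no  a≰b = inj₂ (ℤP.≰⇒> a≰b)

pow2-positive : ∀ p → ℤ.Positive (pow2 p)
pow2-positive p = ℤ.positive (ℤ.+<+ (ℕP.m^n>0 2 p))

pow2-suc : ∀ p → pow2 (suc p) ≡ + 2 ℤ.* pow2 p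
pow2-suc p = ℤP.pos-* 2 (2 ℕ.^ p)

pow2-+ : ∀ p q → pow2 (p ℕ.+ q) ≡ pow2 p ℤ.* pow2 q
pow2-+ p q = trans (cong +_ (ℕP.^-distribˡ-+-* 2 p q)) (ℤP.pos-* (2 ℕ.^ p) (2 ℕ.^ q))

/2^-cong : ∀ {a b} e → a ≡ b → (a /2^ e) ≃D (b /2^ e)
/2^-cong e = cong (ℤ._* pow2 e)

/2^-mono-< : ∀ {a b} e → a ℤ.< b → (a /2^ e) <D (b /2^ e)
/2^-mono-< e = ℤP.*-monoʳ-<-pos (pow2 e) {{pow2-positive e}}

double-/2^ : ∀ a e → ((+ 2 ℤ.* a) /2^ suc e) ≃D (a /2^ e)
double-/2^ a e = begin
  + 2 ℤ.* a ℤ.* pow2 e     ≡⟨ regroup a (pow2 e) ⟩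
  a ℤ.* (+ 2 ℤ.* pow2 e)   ≡⟨ cong (a ℤ.*_) (pow2-suc e) ⟨
  a ℤ.* pow2 (suc e)       ∎
  where
  open ≡-Reasoning
  regroup : ∀ a E → + 2 ℤ.* a ℤ.* E ≡ a ℤ.* (+ 2 ℤ.* E)
  regroup = solve-∀

+D-monoʳ-< : ∀ x y z → y <D z → x +D y <D x +D z
+D-monoʳ-< (a /2^ p) (b /2^ q) (c /2^ r) bR<cQ = begin-strict
  (a * Q + b * P) * pow2 (p ℕ.+ r)   ≡⟨ cong ((a * Q + b * P) *_) (pow2-+ p r) ⟩
  (a * Q + b * P) * (P * R)          ≡⟨ expandˡ a b P Q R ⟩
  a * P * Q * R + P * (P * (b * R))  <⟨ ℤP.+-monoʳ-< (a * P * Q * R) (scale (scale bR<cQ)) ⟩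
  a * P * Q * R + P * (P * (c * Q))  ≡⟨ expandʳ a c P Q R ⟩
  (a * R + c * P) * (P * Q)          ≡⟨ cong ((a * R + c * P) *_) (pow2-+ p q) ⟨
  (a * R + c * P) * pow2 (p ℕ.+ q)   ∎
  where
  open Data.Integer using (_*_; _+_)
  open ℤP.≤-Reasoning
  P = pow2 p
  Q = pow2 q
  R = pow2 r
  scale : ∀ {i j} → i ℤ.< j → P * i ℤ.< P * j
  scale = ℤP.*-monoˡ-<-pos P {{pow2-positive p}}
  expandˡ : ∀ a b P Q R → (a * Q + b * P) * (P * R) ≡ a * P * Q * R + P * (P * (b * R))
  expandˡ = solve-∀
  expandʳ : ∀ a c P Q R → a * P * Q * R + P * (P * (c * Q)) ≡ (a * R + c * P) * (P * Q)
  expandʳ = solve-∀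

+D-same-exp : ∀ a b e → ((a /2^ e) +D (b /2^ e)) ≃D ((a ℤ.+ b) /2^ e)
+D-same-exp a b e = begin
  (a * E + b * E) * E          ≡⟨ factor a b E ⟩
  (a + b) * (E * E)            ≡⟨ cong ((a + b) *_) (pow2-+ e e) ⟨
  (a + b) * pow2 (e ℕ.+ e)     ∎
  where
  open Data.Integer using (_*_; _+_)
  open ≡-Reasoning
  E = pow2 e
  factor : ∀ a b E → (a * E + b * E) * E ≡ (a + b) * (E * E)
  factor = solve-∀

-D-antimono-< : ∀ x y → x <D y → -D y <D -D x
-D-antimono-< (a /2^ p) (b /2^ q) aQ<bP =
  subst₂ ℤ._<_ (ℤP.neg-distribˡ-* b (pow2 p)) (ℤP.neg-distribˡ-* a (pow2 q)) (ℤP.neg-mono-< aQ<bP)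

int-<D⁻ : ∀ a b → (a /2^ 0) <D (b /2^ 0) → a ℤ.< b
int-<D⁻ a b = subst₂ ℤ._<_ (ℤP.*-identityʳ a) (ℤP.*-identityʳ b)

int-≤D⁺ : ∀ a b → a ℤ.≤ b → (a /2^ 0) ≤D (b /2^ 0)
int-≤D⁺ a b = subst₂ ℤ._≤_ (sym (ℤP.*-identityʳ a)) (sym (ℤP.*-identityʳ b))

-- If exp x ≤ e, then x · 2^e would be an integer strictly between N and N + 1.
exp-between-consecutive : ∀ N e x → (N /2^ e) <D x → x <D ((N ℤ.+ 1ℤ) /2^ e) → e ℕ.< exp x
exp-between-consecutive N e (b /2^ s) N<x x<N+1 with e ℕ.<? s
... | yes e<s = e<s
... | no  e≮s = ⊥-elim (no-integer-strictly-between
                  (ℤP.*-cancelʳ-<-nonNeg {N} {b ℤ.* pow2 d} (pow2 s) (subst (N ℤ.* pow2 s ℤ.<_) rescale N<x))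
                  (ℤP.*-cancelʳ-<-nonNeg {b ℤ.* pow2 d} (pow2 s) (subst (ℤ._< (N ℤ.+ 1ℤ) ℤ.* pow2 s) rescale x<N+1)))
  where
  d = e ℕ.∸ s
  regroup : ∀ b S D → b ℤ.* (S ℤ.* D) ≡ b ℤ.* D ℤ.* S
  regroup = solve-∀
  rescale : b ℤ.* pow2 e ≡ b ℤ.* pow2 d ℤ.* pow2 s
  rescale = trans (cong (λ n → b ℤ.* pow2 n) (sym (ℕP.m+[n∸m]≡n (ℕP.≮⇒≥ e≮s))))
                  (trans (cong (b ℤ.*_) (pow2-+ s d)) (regroup b (pow2 s) (pow2 d)))

canonAt-even : ∀ a p → a %ℕ 2 ≡ 0 → canonAt a (suc p) ≡ canonAt (a /ℕ 2) p
canonAt-even a p a%2≡0 rewrite a%2≡0 = refl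

canonAt-odd : ∀ a p → a %ℕ 2 ≡ 1 →
              canonAt a (suc p) ≡ ⟨ canonAt (a /ℕ 2) p ∷ [] ∣ canonAt (a /ℕ 2 ℤ.+ 1ℤ) p ∷ [] ⟩
canonAt-odd a p a%2≡1 rewrite a%2≡1 = refl

canonNeg≡canon : ∀ n → canonNeg n ≡ canon ((- + n) /2^ 0)
canonNeg≡canon zero    = refl
canonNeg≡canon (suc n) = refl

-- The shapes of canonical forms: an integer, or mid k p = (2k+1)/2^(p+1), whose
-- canonical form is { k/2^p | (k+1)/2^p }.
data NumberForm : Set where
  int : ℤ → NumberForm
  mid : ℤ → ℕ → NumberForm

value : NumberForm → Dyadic
value (int c)   = c /2^ 0
value (mid k p) = (+ 2 ℤ.* k ℤ.+ 1ℤ) /2^ suc p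

lefts : NumberForm → List Dyadic
lefts (int +[1+ n ]) = (+ n) /2^ 0 ∷ []
lefts (int _)        = []
lefts (mid k p)      = k /2^ p ∷ []

rights : NumberForm → List Dyadic
rights (int -[1+ n ]) = (- + n) /2^ 0 ∷ []
rights (int _)        = []
rights (mid k p)      = (k ℤ.+ 1ℤ) /2^ p ∷ []

formGame : NumberForm → Game
formGame f = ⟨ map canon (lefts f) ∣ map canon (rights f) ⟩

canonical-formAt : ∀ a p → Σ NumberForm λ f → canonAt a p ≡ formGame f × (a /2^ p) ≃D value f
canonical-formAt (+ zero) zero = int (+ 0) , refl , refl
canonical-formAt +[1+ n ] zero = int +[1+ n ] , refl , refl
canonical-formAt -[1+ n ] zero = int -[1+ n ] , cong (λ G → ⟨ [] ∣ G ∷ [] ⟩) (canonNeg≡canon n) , refl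
canonical-formAt a (suc p) with parity a
... | odd a%2≡1 a≡2h+1 = mid (a /ℕ 2) p , canonAt-odd a p a%2≡1 , /2^-cong (suc p) a≡2h+1
... | even a%2≡0 a≡2h with canonical-formAt (a /ℕ 2) p
...   | f , canon≡ , ≃f = f , trans (canonAt-even a p a%2≡0) canon≡ , (begin-equality
  a /2^ suc p                     ≈⟨ /2^-cong (suc p) a≡2h ⟩
  (+ 2 ℤ.* (a /ℕ 2)) /2^ suc p    ≈⟨ double-/2^ (a /ℕ 2) p ⟩
  (a /ℕ 2) /2^ p                  ≈⟨ ≃f ⟩
  value f                         ∎)
  where open ≤D-Reasoning

canonical-form : ∀ x → Σ NumberForm λ f → canon x ≡ formGame f × x ≃D value f
canonical-form (a /2^ p) = canonical-formAt a p

mid-right-≃ : ∀ k p → ((+ 2 ℤ.* k ℤ.+ 1ℤ ℤ.+ 1ℤ) /2^ suc p) ≃D ((k ℤ.+ 1ℤ) /2^ p)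
mid-right-≃ k p = begin-equality
  (+ 2 ℤ.* k ℤ.+ 1ℤ ℤ.+ 1ℤ) /2^ suc p  ≈⟨ /2^-cong (suc p) (regroup k) ⟩
  (+ 2 ℤ.* (k ℤ.+ 1ℤ)) /2^ suc p      ≈⟨ double-/2^ (k ℤ.+ 1ℤ) p ⟩
  (k ℤ.+ 1ℤ) /2^ p                    ∎
  where
  open ≤D-Reasoning
  regroup : ∀ k → + 2 ℤ.* k ℤ.+ 1ℤ ℤ.+ 1ℤ ≡ + 2 ℤ.* (k ℤ.+ 1ℤ)
  regroup = solve-∀

lefts-below : ∀ f {l} → l ∈ lefts f → l <D value f
lefts-below (int +[1+ n ]) (here refl) = /2^-mono-< 0 (ℤ.+<+ (ℕP.n<1+n n))
lefts-below (mid k p)      (here refl) = begin-strict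
  k /2^ p                  ≈⟨ double-/2^ k p ⟨
  (+ 2 ℤ.* k) /2^ suc p    <⟨ /2^-mono-< (suc p) (i<i+1 (+ 2 ℤ.* k)) ⟩
  value (mid k p)          ∎
  where open ≤D-Reasoning

rights-above : ∀ f {r} → r ∈ rights f → value f <D r
rights-above (int -[1+ n ]) (here refl) = /2^-mono-< 0 (ℤP.neg-mono-< (ℤ.+<+ (ℕP.n<1+n n)))
rights-above (mid k p)      (here refl) = begin-strict
  value (mid k p)                      <⟨ /2^-mono-< (suc p) (i<i+1 (+ 2 ℤ.* k ℤ.+ 1ℤ)) ⟩
  (+ 2 ℤ.* k ℤ.+ 1ℤ ℤ.+ 1ℤ) /2^ suc p  ≈⟨ mid-right-≃ k p ⟩
  (k ℤ.+ 1ℤ) /2^ p                     ∎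
  where open ≤D-Reasoning

exp-above-mid : ∀ k p y → value (mid k p) <D y → y <D ((k ℤ.+ 1ℤ) /2^ p) → suc p ℕ.< exp y
exp-above-mid k p y v<y y<r = exp-between-consecutive (+ 2 ℤ.* k ℤ.+ 1ℤ) (suc p) y v<y (begin-strict
  y                                    <⟨ y<r ⟩
  (k ℤ.+ 1ℤ) /2^ p                     ≈⟨ mid-right-≃ k p ⟨
  (+ 2 ℤ.* k ℤ.+ 1ℤ ℤ.+ 1ℤ) /2^ suc p  ∎)
  where open ≤D-Reasoning

exp-below-mid : ∀ l q x → (l /2^ q) <D x → x <D value (mid l q) → suc q ℕ.< exp x
exp-below-mid l q x l<x x<v = exp-between-consecutive (+ 2 ℤ.* l) (suc q) x (begin-strict
  (+ 2 ℤ.* l) /2^ suc q  ≈⟨ double-/2^ l q ⟩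
  l /2^ q                <⟨ l<x ⟩
  x                      ∎) x<v
  where open ≤D-Reasoning

-- The Simplicity Theorem in the form used to compare canonical forms.
separation : ∀ f g → value f <D value g →
             (Σ Dyadic λ r → r ∈ rights f × r ≤D value g) ⊎ (Σ Dyadic λ l → l ∈ lefts g × value f ≤D l)
separation (mid k p) g v<w with ≤D-or->D ((k ℤ.+ 1ℤ) /2^ p) (value g)
... | inj₁ r≤w = inj₁ (_ , here refl , r≤w)
... | inj₂ w<r with g | v<w | exp-above-mid k p (value g) v<w w<r
...   | int _   | _   | ()
...   | mid l q | v<w | p<q with ≤D-or->D (value (mid k p)) (l /2^ q)
...     | inj₁ v≤l = inj₂ (_ , here refl , v≤l)
...     | inj₂ l<v = ⊥-elim (ℕP.<-asym p<q (exp-below-mid l q (value (mid k p)) l<v v<w))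
separation (int c) (mid l q) c<v with ≤D-or->D (c /2^ 0) (l /2^ q)
... | inj₁ c≤l = inj₂ (_ , here refl , c≤l)
... | inj₂ l<c with exp-below-mid l q (c /2^ 0) l<c c<v
...   | ()
separation (int c) (int +[1+ m ]) c<d =
  inj₂ (_ , here refl , int-≤D⁺ c (+ m) (ℤP.i<j⇒i≤pred[j] (int-<D⁻ c +[1+ m ] c<d)))
separation (int -[1+ n ]) (int (+ zero)) _ =
  inj₁ (_ , here refl , int-≤D⁺ (- + n) (+ 0) ℤP.neg-≤-pos)
separation (int -[1+ n ]) (int -[1+ m ]) c<d =
  inj₁ (_ , here refl , int-≤D⁺ (- + n) -[1+ m ] (subst (ℤ._≤ -[1+ m ]) (-[1+n]+1≡-n n) (ℤP.i<j⇒suc[i]≤j (int-<D⁻ -[1+ n ] -[1+ m ] c<d))))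
separation (int (+ c)) (int (+ zero)) c<d = ⊥-elim (ℤP.<⇒≱ (int-<D⁻ (+ c) (+ 0) c<d) (ℤ.+≤+ ℕ.z≤n))
separation (int (+ c)) (int -[1+ m ]) c<d = ⊥-elim (ℤP.<⇒≱ (int-<D⁻ (+ c) -[1+ m ] c<d) ℤ.-≤+)

rights-exp-≤ : ∀ f x → x ≃D value f → ∀ {r} → r ∈ rights f → exp r ℕ.≤ exp x
rights-exp-≤ (int -[1+ n ]) x _   (here refl) = ℕ.z≤n
rights-exp-≤ (mid l q)      x x≃v (here refl) = ℕP.<⇒≤ (exp-between-consecutive l q x
  (begin-strict l /2^ q <⟨ lefts-below (mid l q) (here refl) ⟩ value (mid l q) ≈⟨ x≃v ⟨ x ∎)
  (begin-strict x ≈⟨ x≃v ⟩ value (mid l q) <⟨ rights-above (mid l q) (here refl) ⟩ (l ℤ.+ 1ℤ) /2^ q ∎))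
  where open ≤D-Reasoning

canon-leftOpt : ∀ x {Z} → Z ∈ leftOpts (canon x) → Σ Dyadic λ l → Z ≡ canon l × l <D x
canon-leftOpt x Z∈ with canonical-form x
... | f , canon≡ , x≃f with ∈-map⁻ canon (subst (_ ∈_) (cong leftOpts canon≡) Z∈)
...   | l , l∈ , Z≡ = l , Z≡ , (begin-strict l <⟨ lefts-below f l∈ ⟩ value f ≈⟨ x≃f ⟨ x ∎)
  where open ≤D-Reasoning

canon-rightOpt : ∀ x {Z} → Z ∈ rightOpts (canon x) → Σ Dyadic λ r → Z ≡ canon r × x <D r
canon-rightOpt x Z∈ with canonical-form x
... | f , canon≡ , x≃f with ∈-map⁻ canon (subst (_ ∈_) (cong rightOpts canon≡) Z∈)
...   | r , r∈ , Z≡ = r , Z≡ , (begin-strict x ≈⟨ x≃f ⟩ value f <⟨ rights-above f r∈ ⟩ r ∎)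
  where open ≤D-Reasoning

canon-separation : ∀ x y → x <D y →
                   (Σ Dyadic λ r → canon r ∈ rightOpts (canon x) × r ≤D y) ⊎
                   (Σ Dyadic λ l → canon l ∈ leftOpts (canon y) × x ≤D l)
canon-separation x y x<y with canonical-form x | canonical-form y
... | f , canonx≡ , x≃f | g , canony≡ , y≃g = Sum.map via-right via-left (separation f g f<g)
  where
  open ≤D-Reasoning
  f<g : value f <D value g
  f<g = begin-strict value f ≈⟨ x≃f ⟨ x <⟨ x<y ⟩ y ≈⟨ y≃g ⟩ value g ∎
  via-right : (Σ Dyadic λ r → r ∈ rights f × r ≤D value g) → Σ Dyadic λ r → canon r ∈ rightOpts (canon x) × r ≤D y
  via-right (r , r∈ , r≤g) =
    r , subst (_ ∈_) (cong rightOpts (sym canonx≡)) (∈-map⁺ canon r∈) , (begin r ≤⟨ r≤g ⟩ value g ≈⟨ y≃g ⟨ y ∎)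
  via-left : (Σ Dyadic λ l → l ∈ lefts g × value f ≤D l) → Σ Dyadic λ l → canon l ∈ leftOpts (canon y) × x ≤D l
  via-left (l , l∈ , f≤l) =
    l , subst (_ ∈_) (cong leftOpts (sym canony≡)) (∈-map⁺ canon l∈) , (begin x ≈⟨ x≃f ⟩ value f ≤⟨ f≤l ⟩ l ∎)

mutual
  canon-mono-acc : ∀ {x y} → Acc Option (canon x) → Acc Option (canon y) → x ≤D y → canon x ≤G canon y
  canon-mono-acc {x} {y} (acc rx) (acc ry) x≤y = ≤G-intro left right
    where
    left : ∀ {Z} → Z ∈ leftOpts (canon x) → ¬ canon y ≤G Z
    left Z∈ with canon-leftOpt x Z∈
    ... | l , refl , l<x = canon-<⇒≱-acc {l} {y} (rx (inj₁ Z∈)) (acc ry) (begin-strict l <⟨ l<x ⟩ x ≤⟨ x≤y ⟩ y ∎)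
      where open ≤D-Reasoning
    right : ∀ {Z} → Z ∈ rightOpts (canon y) → ¬ Z ≤G canon x
    right Z∈ with canon-rightOpt y Z∈
    ... | r , refl , y<r = canon-<⇒≱-acc {x} {r} (acc rx) (ry (inj₂ Z∈)) (begin-strict x ≤⟨ x≤y ⟩ y <⟨ y<r ⟩ r ∎)
      where open ≤D-Reasoning

  canon-<⇒≱-acc : ∀ {x y} → Acc Option (canon x) → Acc Option (canon y) → x <D y → ¬ canon y ≤G canon x
  canon-<⇒≱-acc {x} {y} (acc rx) (acc ry) x<y y≤x = [ via-right , via-left ]′ (canon-separation x y x<y)
    where
    via-right : ¬ Σ Dyadic λ r → canon r ∈ rightOpts (canon x) × r ≤D y
    via-right (r , r∈ , r≤y) = ¬rightOpt≤ r∈ (≤G-trans (canon-mono-acc {r} {y} (rx (inj₂ r∈)) (acc ry) r≤y) y≤x)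
    via-left : ¬ Σ Dyadic λ l → canon l ∈ leftOpts (canon y) × x ≤D l
    via-left (l , l∈ , x≤l) = ¬≤leftOpt l∈ (≤G-trans y≤x (canon-mono-acc {x} {l} (acc rx) (ry (inj₁ l∈)) x≤l))

canon-mono : ∀ {x y} → x ≤D y → canon x ≤G canon y
canon-mono {x} {y} = canon-mono-acc {x} {y} (option-wellFounded (canon x)) (option-wellFounded (canon y))

canon-<⇒≱ : ∀ {x y} → x <D y → ¬ canon y ≤G canon x
canon-<⇒≱ {x} {y} = canon-<⇒≱-acc {x} {y} (option-wellFounded (canon x)) (option-wellFounded (canon y))

number-comparable : ∀ {G} → IsNumber G → ∀ m → G ≤G canon m ⊎ canon m ≤G G
number-comparable ((x , G≤x , x≤G)) m with ≤D-or->D x m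
... | inj₁ x≤m = inj₁ (≤G-trans G≤x (canon-mono {x} {m} x≤m))
... | inj₂ m<x = inj₂ (≤G-trans (canon-mono {m} {x} (<D⇒≤D {m} {x} m<x)) x≤G)

canon-rightOpt-≥ : ∀ x {Z} → Z ∈ rightOpts (canon x) → Σ Dyadic λ r → Z ≡ canon r × ((num x ℤ.+ 1ℤ) /2^ exp x) ≤D r
canon-rightOpt-≥ x Z∈ with canonical-form x
... | f , canon≡ , x≃f with ∈-map⁻ canon (subst (_ ∈_) (cong rightOpts canon≡) Z∈)
...   | r , r∈ , Z≡ with ≤D-or->D ((num x ℤ.+ 1ℤ) /2^ exp x) r
...     | inj₁ x+1≤r = r , Z≡ , x+1≤r
...     | inj₂ r<x+1 = ⊥-elim (ℕP.<⇒≱ (exp-between-consecutive (num x) (exp x) r x<r r<x+1) (rights-exp-≤ f x x≃f r∈))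
  where
  open ≤D-Reasoning
  x<r : x <D r
  x<r = begin-strict x ≈⟨ x≃f ⟩ value f <⟨ rights-above f r∈ ⟩ r ∎

ball≉centre-by-leftOpt : ∀ {m Δ l} → canon l ∈ leftOpts (canon m) → m +D Δ <D l →
                       (∀ {Z} → Z ∈ rightOpts (canon l) → Σ Dyadic λ r → Z ≡ canon r × m <D r) →
                       ¬ ball m Δ ≈G canon m
ball≉centre-by-leftOpt {m} {Δ} {l} l∈ m+Δ<l l-rights-above-m (ball≤m , m≤ball) = ≤G-elimˡ m≤ball l∈ ball≤l
  where
  right : ∀ {Z} → Z ∈ rightOpts (canon l) → ¬ Z ≤G ball m Δ
  right Z∈ Z≤ball with l-rights-above-m Z∈
  ... | r , refl , m<r = canon-<⇒≱ {m} {r} m<r (≤G-trans Z≤ball ball≤m)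
  ball≤l : ball m Δ ≤G canon l
  ball≤l = ≤G-intro (λ { (here refl) → canon-<⇒≱ {m +D Δ} {l} m+Δ<l ; (there ()) }) right

ball≉centre-by-rightOpt : ∀ {m Δ r} → canon r ∈ rightOpts (canon m) → r <D m -D Δ →
                        (∀ {Z} → Z ∈ leftOpts (canon r) → Σ Dyadic λ l → Z ≡ canon l × l <D m) →
                        ¬ ball m Δ ≈G canon m
ball≉centre-by-rightOpt {m} {Δ} {r} r∈ r<m-Δ r-lefts-below-m (ball≤m , m≤ball) = ≤G-elimʳ ball≤m r∈ r≤ball
  where
  left : ∀ {Z} → Z ∈ leftOpts (canon r) → ¬ ball m Δ ≤G Z
  left Z∈ ball≤Z with r-lefts-below-m Z∈
  ... | l , refl , l<m = canon-<⇒≱ {l} {m} l<m (≤G-trans m≤ball ball≤Z)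
  r≤ball : canon r ≤G ball m Δ
  r≤ball = ≤G-intro left (λ { (here refl) → canon-<⇒≱ {r} {m -D Δ} r<m-Δ ; (there ()) })

canonℕ-no-rightOpts : ∀ n {Z} → ¬ Z ∈ rightOpts (canonℕ n)
canonℕ-no-rightOpts zero    ()
canonℕ-no-rightOpts (suc n) ()

canonNeg-no-leftOpts : ∀ n {Z} → ¬ Z ∈ leftOpts (canonNeg n)
canonNeg-no-leftOpts zero    ()
canonNeg-no-leftOpts (suc n) ()

ball≉centre-pos : ∀ n Δ → Δ <D (-[1+ 0 ] /2^ 0) → ¬ ball (+[1+ n ] /2^ 0) Δ ≈G canon (+[1+ n ] /2^ 0)
ball≉centre-pos n Δ Δ<-1 =
  ball≉centre-by-leftOpt {m} {Δ} {(+ n) /2^ 0} (here refl) m+Δ<n (⊥-elim ∘ canonℕ-no-rightOpts n)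
  where
  open ≤D-Reasoning
  m = +[1+ n ] /2^ 0
  m+Δ<n = begin-strict
    m +D Δ                  <⟨ +D-monoʳ-< m Δ (-[1+ 0 ] /2^ 0) Δ<-1 ⟩
    m +D (-[1+ 0 ] /2^ 0)   ≈⟨ +D-same-exp +[1+ n ] -[1+ 0 ] 0 ⟩
    (+ n) /2^ 0             ∎

ball≉centre-neg : ∀ n Δ → Δ <D (-[1+ 0 ] /2^ 0) → ¬ ball (-[1+ n ] /2^ 0) Δ ≈G canon (-[1+ n ] /2^ 0)
ball≉centre-neg n Δ Δ<-1 =
  ball≉centre-by-rightOpt {m} {Δ} {(- + n) /2^ 0} (subst (_∈ rightOpts (canon m)) (canonNeg≡canon n) (here refl)) -n<m-Δ
    (λ Z∈ → ⊥-elim (canonNeg-no-leftOpts n (subst (_ ∈_) (cong leftOpts (sym (canonNeg≡canon n))) Z∈)))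
  where
  open ≤D-Reasoning
  m = -[1+ n ] /2^ 0
  -n<m-Δ = begin-strict
    (- + n) /2^ 0            ≈⟨ /2^-cong 0 (-[1+n]+1≡-n n) ⟨
    (-[1+ n ] ℤ.+ 1ℤ) /2^ 0  ≈⟨ +D-same-exp -[1+ n ] 1ℤ 0 ⟨
    m +D (1ℤ /2^ 0)          <⟨ +D-monoʳ-< m (1ℤ /2^ 0) (-D Δ) (-D-antimono-< Δ (-[1+ 0 ] /2^ 0) Δ<-1) ⟩
    m -D Δ                   ∎

ball≉centre-odd : ∀ a p Δ → a %ℕ 2 ≡ 1 → a ≡ + 2 ℤ.* (a /ℕ 2) ℤ.+ 1ℤ → Δ <D (-[1+ 0 ] /2^ suc p) →
                  ¬ ball (a /2^ suc p) Δ ≈G canon (a /2^ suc p)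
ball≉centre-odd a p Δ a%2≡1 a≡2h+1 Δ<-ε =
  ball≉centre-by-leftOpt {m} {Δ} {h /2^ p} (subst (canonAt h p ∈_) (cong leftOpts (sym (canonAt-odd a p a%2≡1))) (here refl))
    m+Δ<h h-rights-above-m
  where
  open ≤D-Reasoning
  h = a /ℕ 2
  m = a /2^ suc p
  a-1≡2h : a ℤ.+ -[1+ 0 ] ≡ + 2 ℤ.* h
  a-1≡2h = trans (cong (ℤ._+ -[1+ 0 ]) a≡2h+1) (cancel (+ 2 ℤ.* h))
    where cancel : ∀ i → i ℤ.+ 1ℤ ℤ.+ -[1+ 0 ] ≡ i
          cancel = solve-∀
  m+Δ<h = begin-strict
    m +D Δ                      <⟨ +D-monoʳ-< m Δ (-[1+ 0 ] /2^ suc p) Δ<-ε ⟩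
    m +D (-[1+ 0 ] /2^ suc p)   ≈⟨ +D-same-exp a -[1+ 0 ] (suc p) ⟩
    (a ℤ.+ -[1+ 0 ]) /2^ suc p  ≈⟨ /2^-cong (suc p) a-1≡2h ⟩
    (+ 2 ℤ.* h) /2^ suc p       ≈⟨ double-/2^ h p ⟩
    h /2^ p                     ∎
  h-rights-above-m : ∀ {Z} → Z ∈ rightOpts (canon (h /2^ p)) → Σ Dyadic λ r → Z ≡ canon r × m <D r
  h-rights-above-m Z∈ with canon-rightOpt-≥ (h /2^ p) Z∈
  ... | r , Z≡ , h+1≤r = r , Z≡ , (begin-strict
    m                  ≈⟨ /2^-cong (suc p) a≡2h+1 ⟩
    value (mid h p)    <⟨ rights-above (mid h p) (here refl) ⟩
    (h ℤ.+ 1ℤ) /2^ p   ≤⟨ h+1≤r ⟩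
    r                  ∎)

ball≉centre : ∀ a p Δ → (OddInt a ⊎ p ≡ 0) → a ≢ + 0 → Δ <D (-[1+ 0 ] /2^ p) →
              ¬ ball (a /2^ p) Δ ≈G canon (a /2^ p)
ball≉centre (+ zero) zero    Δ _ a≢0 _    = ⊥-elim (a≢0 refl)
ball≉centre +[1+ n ] zero    Δ _ _   Δ<-1 = ball≉centre-pos n Δ Δ<-1
ball≉centre -[1+ n ] zero    Δ _ _   Δ<-1 = ball≉centre-neg n Δ Δ<-1
ball≉centre a        (suc p) Δ (inj₂ ()) _ _
ball≉centre a        (suc p) Δ (inj₁ (k , a≡2k+1)) _ Δ<-ε with parity a
... | even _ a≡2h        = ⊥-elim (even≢odd (a /ℕ 2) k (trans (sym a≡2h) a≡2k+1))
... | odd a%2≡1 a≡2h+1   = ball≉centre-odd a p Δ a%2≡1 a≡2h+1 Δ<-ε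

proposition2p10 : (a : ℤ) (p : ℕ) (Δ : Dyadic) →
    (OddInt a ⊎ p ≡ 0) → a ≢ + 0 → Δ <D 0D →
    IsBalancedNumber (a /2^ p) Δ →
    ((-[1+ 0 ] /2^ p) ≤D Δ) × (Δ <D 0D)
proposition2p10 a p Δ odd-or-integer a≢0 Δ<0 (ball-number , balanced) = lower-bound , Δ<0
  where
  ball≈centre : ball (a /2^ p) Δ ≈G canon (a /2^ p)
  ball≈centre = ≈G-of-doubles balanced (number-comparable ball-number (a /2^ p))
  lower-bound : (-[1+ 0 ] /2^ p) ≤D Δ
  lower-bound with ≤D-or->D (-[1+ 0 ] /2^ p) Δ
  ... | inj₁ -ε≤Δ = -ε≤Δ
  ... | inj₂ Δ<-ε = ⊥-elim (ball≉centre a p Δ odd-or-integer a≢0 Δ<-ε ball≈centre)
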